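{- Let $p$ be a prime and let $\mathcal{M}\subseteq\mathbb{F}_p^*$ be a set of cardinality $M$. For an integer $T\in[1,p)$, let $J(T,\mathcal{M})$ denote the number of quadruples $(x,y,m,n)$ with integers $x,y\in[1,T]$ and $m,n\in\mathcal{M}$ such that $xm\equiv yn\pmod p$. Then for any integers $H,K\in[1,p)$ we have, uniformly, $$ K\,J(H,\mathcal{M})=H\,J(K,\mathcal{M})+O\big((H+K)(HKp^{ -1}+1)M^2\big). $$
   Context: $\mathbb{F}_p$ is the field with $p$ elements, identified with $\{0,1,\ldots,p-1\}$, and $\mathbb{F}_p^*=\mathbb{F}_p\setminus\{0\}$. $U=O(V)$ means $|U|\le cV$ for an absolute constant $c>0$ (independent of $p,H,K,\mathcal{M}$). -}

module Defs where

open import Data.Nat using (ℕ; suc; _+_; _*_; _%_; NonZero)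
open import Data.Nat.Properties using (_≟_)
open import Data.Fin using (Fin; toℕ)
open import Data.Fin.Subset using (Subset)
open import Data.Fin.Subset.Properties using (_∈?_)
open import Data.List using (List; map; upTo; allFin)
open import Data.Nat.ListAction using (sum)
open import Data.Bool using (if_then_else_; _∧_)
open import Relation.Nullary using (does)

range1 : ℕ → List ℕ
range1 T = map suc (upTo T)

-- J(T, 𝓜): number of quadruples (x,y,m,n), x,y ∈ [1,T], m,n ∈ 𝓜,
-- with x m ≡ y n (mod p).  Elements of F_p are Fin p, identified with 0..p-1.
J : (p : ℕ) .{{_ : NonZero p}} → Subset p → ℕ → ℕ
J p 𝓜 T =
  sum (map (λ x →
  sum (map (λ y →
  sum (map (λ m →
  sum (map (λ n →
    if does (m ∈? 𝓜) ∧ does (n ∈? 𝓜)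
         ∧ does (((x * toℕ m) % p) ≟ ((y * toℕ n) % p))
    then 1 else 0) (allFin p))) (allFin p))) (range1 T))) (range1 T))

module Submission where

-- For m, n ∈ 𝓜 let N(T) = N_{m,n}(T) count the points of [1, T]² on the lattice
-- L(m, n) = {(x, y) : x m ≡ y n (mod p)}; then J(T) = Σ_{m,n ∈ 𝓜} N_{m,n}(T), so it suffices
-- to prove the pair bound  p K N(H) ≤ p H N(K) + 4 (H + K)(H K + p)  for each pair.
-- The smallest box [1, w]² meeting L(m, n) yields (after possibly transposing) a short
-- vector (w, v): 1 ≤ v ≤ w and no lattice point in [1, w)².  Then
--   * the multiples k (w, v) give the lower bound  T ≤ w N(T) + w;
--   * for T < p each row contains at most one lattice point, and within a block of w rows
--     distinct points lie on distinct lines x v + (T − y) w = h parallel to (w, v), whose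
--     heights h are congruent mod p; hence  p w N(T) ≤ (T + w)(2 T w + p).
-- Comparing the two bounds gives the pair bound, and summing over 𝓜² the theorem.

open import Defs
open import Data.Nat using (ℕ; _+_; _*_; _^_; _≤_; _<_; ∣_-_∣; NonZero)
open import Data.Nat.Primality using (Prime)
open import Data.Fin using (toℕ)
open import Data.Fin.Subset using (Subset; _∈_; ∣_∣)
open import Data.Product using (Σ; _,_)
open import Relation.Binary.PropositionalEquality using (_≢_)

open import Data.Nat
  using (zero; suc; pred; _∸_; _/_; _%_; z≤n; s≤s; _≟_; _≤?_; _<?_; >-nonZero)
open import Data.Nat.Properties
open import Data.Nat.DivMod
open import Data.Nat.Divisibility using (_∣_; divides; ∣⇒≤)
open import Data.Nat.Primality using (euclidsLemma)
open import Data.Nat.Tactic.RingSolver using (solve-∀)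
open import Data.Fin as Fin using (Fin; fromℕ<; punchOut; combine)
open import Data.Fin.Properties using (toℕ<n; ¬Fin0; punchOut-injective; fromℕ<-injective; remQuot-combine)
open import Data.Fin.Subset using (inside; outside)
open import Data.Fin.Subset.Properties using (_∈?_)
open import Data.Vec using ([]; _∷_)
open import Data.List using (List; map; applyUpTo; tabulate; allFin)
  renaming ([] to []ₗ; _∷_ to _∷ₗ_)
open import Data.List.Properties using (map-∘; map-tabulate)
open import Data.Nat.ListAction using (sum)
open import Data.Bool using (Bool; true; false; if_then_else_; _∧_)
open import Data.Product using (_×_; proj₁; proj₂)
open import Data.Sum using (_⊎_; inj₁; inj₂)
open import Relation.Binary.Definitions using (tri<; tri≈; tri>)
open import Data.Empty using (⊥-elim)
open import Function using (_∘_; id)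
open import Relation.Nullary using (¬_; Dec; yes; no; does)
open import Relation.Binary.PropositionalEquality
  using (_≡_; refl; sym; trans; cong; cong₂; subst; subst₂; module ≡-Reasoning)

bit : Bool → ℕ
bit b = if b then 1 else 0

bit-∧ : ∀ b₁ b₂ → bit (b₁ ∧ b₂) ≡ bit b₁ * bit b₂
bit-∧ true  true  = refl
bit-∧ true  false = refl
bit-∧ false _     = refl

𝟙 : {P : Set} → Dec P → ℕ
𝟙 d = bit (does d)

𝟙≤1 : {P : Set} (d : Dec P) → 𝟙 d ≤ 1
𝟙≤1 (yes _) = s≤s z≤n
𝟙≤1 (no _)  = z≤n

𝟙-sound : {P : Set} (d : Dec P) → 1 ≤ 𝟙 d → P
𝟙-sound (yes p) _ = p

𝟙-complete : {P : Set} (d : Dec P) → P → 𝟙 d ≡ 1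
𝟙-complete (yes _) _  = refl
𝟙-complete (no ¬p) p  = ⊥-elim (¬p p)

𝟙-cong : {P Q : Set} → (P → Q) → (Q → P) → (d : Dec P) (e : Dec Q) → 𝟙 d ≡ 𝟙 e
𝟙-cong _ _ (yes _) (yes _) = refl
𝟙-cong _ _ (no _)  (no _)  = refl
𝟙-cong f _ (yes p) (no ¬q) = ⊥-elim (¬q (f p))
𝟙-cong _ g (no ¬p) (yes q) = ⊥-elim (¬p (g q))

∑< : ℕ → (ℕ → ℕ) → ℕ
∑< zero    f = 0
∑< (suc n) f = f 0 + ∑< n (f ∘ suc)

∑<-cong : ∀ n {f g : ℕ → ℕ} → (∀ i → i < n → f i ≡ g i) → ∑< n f ≡ ∑< n g
∑<-cong zero    e = refl
∑<-cong (suc n) e = cong₂ _+_ (e 0 (s≤s z≤n)) (∑<-cong n (λ i i<n → e (suc i) (s≤s i<n)))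

∑<-zeros : ∀ n → ∑< n (λ _ → 0) ≡ 0
∑<-zeros zero    = refl
∑<-zeros (suc n) = ∑<-zeros n

∑<-+ : ∀ n (f g : ℕ → ℕ) → ∑< n (λ i → f i + g i) ≡ ∑< n f + ∑< n g
∑<-+ zero    f g = refl
∑<-+ (suc n) f g = trans (cong (f 0 + g 0 +_) (∑<-+ n (f ∘ suc) (g ∘ suc)))
                         (interchange (f 0) (g 0) _ _)
  where
  interchange : ∀ a b c d → a + b + (c + d) ≡ a + c + (b + d)
  interchange = solve-∀

∑<-split : ∀ m n (f : ℕ → ℕ) → ∑< (m + n) f ≡ ∑< m f + ∑< n (λ i → f (m + i))
∑<-split zero    n f = refl
∑<-split (suc m) n f = trans (cong (f 0 +_) (∑<-split m n (f ∘ suc))) (sym (+-assoc (f 0) _ _))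

∑<-prefix : ∀ {m n} (f : ℕ → ℕ) → m ≤ n → ∑< m f ≤ ∑< n f
∑<-prefix {m} {n} f m≤n = subst (∑< m f ≤_)
  (trans (sym (∑<-split m (n ∸ m) f)) (cong (λ k → ∑< k f) (m+[n∸m]≡n m≤n)))
  (m≤m+n (∑< m f) _)

∑<-swap : ∀ m n (f : ℕ → ℕ → ℕ) →
  ∑< m (λ i → ∑< n (λ j → f i j)) ≡ ∑< n (λ j → ∑< m (λ i → f i j))
∑<-swap zero    n f = sym (∑<-zeros n)
∑<-swap (suc m) n f = trans (cong (∑< n (f 0) +_) (∑<-swap m n (f ∘ suc)))
                            (sym (∑<-+ n (f 0) (λ j → ∑< m (λ i → f (suc i) j))))

term≤∑< : ∀ n (f : ℕ → ℕ) {i} → i < n → f i ≤ ∑< n f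
term≤∑< (suc n) f {zero}  _         = m≤m+n (f 0) _
term≤∑< (suc n) f {suc i} (s≤s i<n) = ≤-trans (term≤∑< n (f ∘ suc) i<n) (m≤n+m _ (f 0))

-- The first index below n carrying a positive term (meaningful when the sum is positive).
firstPos : (ℕ → ℕ) → ℕ → ℕ
firstPos f zero    = 0
firstPos f (suc n) with f 0
... | zero  = suc (firstPos (f ∘ suc) n)
... | suc _ = 0

firstPos-spec : ∀ (f : ℕ → ℕ) n → 1 ≤ ∑< n f → firstPos f n < n × 1 ≤ f (firstPos f n)
firstPos-spec f zero    ()
firstPos-spec f (suc n) pos with f 0 in f0
... | suc _ = s≤s z≤n , subst (1 ≤_) (sym f0) (s≤s z≤n)
... | zero with firstPos-spec (f ∘ suc) n pos
...   | below , positive = s≤s below , positive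

count-by-code : ∀ N {n} (χ : ℕ → ℕ) → (∀ i → χ i ≤ 1) →
  (code : ∀ i → i < N → 1 ≤ χ i → Fin n) →
  (∀ i j (i<N : i < N) (j<N : j < N) (χi : 1 ≤ χ i) (χj : 1 ≤ χ j) →
     code i i<N χi ≡ code j j<N χj → i ≡ j) →
  ∑< N χ ≤ n
count-by-code zero χ χ≤1 code inj = z≤n
count-by-code (suc N) {n} χ χ≤1 code inj with 1 ≤? χ 0
... | no χ0≢1 = begin
  χ 0 + ∑< N (χ ∘ suc) ≡⟨ cong (_+ ∑< N (χ ∘ suc)) (n<1⇒n≡0 (≰⇒> χ0≢1)) ⟩
  ∑< N (χ ∘ suc)       ≤⟨ count-by-code N (χ ∘ suc) (χ≤1 ∘ suc) shifted shifted-inj ⟩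
  n                    ∎
  where
  open ≤-Reasoning
  shifted : ∀ i → i < N → 1 ≤ χ (suc i) → Fin n
  shifted i i<N = code (suc i) (s≤s i<N)
  shifted-inj : ∀ i j i<N j<N χi χj → shifted i i<N χi ≡ shifted j j<N χj → i ≡ j
  shifted-inj i j i<N j<N χi χj e = suc-injective (inj _ _ _ _ χi χj e)
count-by-code (suc N) {zero} χ χ≤1 code inj | yes χ0 = ⊥-elim (¬Fin0 (code 0 (s≤s z≤n) χ0))
count-by-code (suc N) {suc n'} χ χ≤1 code inj | yes χ0 = begin
  χ 0 + ∑< N (χ ∘ suc) ≤⟨ +-monoˡ-≤ _ (χ≤1 0) ⟩
  suc (∑< N (χ ∘ suc)) ≤⟨ s≤s (count-by-code N (χ ∘ suc) (χ≤1 ∘ suc) punched punched-inj) ⟩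
  suc n'               ∎
  where
  open ≤-Reasoning
  c0 : Fin (suc n')
  c0 = code 0 (s≤s z≤n) χ0
  -- every other coded position avoids the code c0 of position 0, so the codes
  -- of positions 1, 2, … can be compressed into Fin n' by punching out c0
  avoids : ∀ i (i<N : i < N) χi → c0 ≢ code (suc i) (s≤s i<N) χi
  avoids i i<N χi e = 0≢1+n (inj _ _ _ _ χ0 χi e)
  punched : ∀ i → i < N → 1 ≤ χ (suc i) → Fin n'
  punched i i<N χi = punchOut (avoids i i<N χi)
  punched-inj : ∀ i j i<N j<N χi χj → punched i i<N χi ≡ punched j j<N χj → i ≡ j
  punched-inj i j i<N j<N χi χj e =
    suc-injective (inj _ _ _ _ χi χj (punchOut-injective (avoids i i<N χi) (avoids j j<N χj) e))

divmod-≡ : ∀ {x y} n .{{_ : NonZero n}} → x / n ≡ y / n → x % n ≡ y % n → x ≡ y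
divmod-≡ {x} {y} n q≡ r≡ = begin
  x               ≡⟨ m≡m%n+[m/n]*n x n ⟩
  x % n + x / n * n ≡⟨ cong₂ (λ r q → r + q * n) r≡ q≡ ⟩
  y % n + y / n * n ≡⟨ m≡m%n+[m/n]*n y n ⟨
  y               ∎
  where open ≡-Reasoning

same-block : ∀ i j w .{{_ : NonZero w}} → i / w ≡ j / w → j ∸ i < w
same-block i j w q≡ = begin-strict
  j ∸ i                                     ≡⟨ cong₂ _∸_ (split j) (split i) ⟩
  (j / w * w + j % w) ∸ (i / w * w + i % w) ≡⟨ cong (λ q → (j / w * w + j % w) ∸ (q * w + i % w)) q≡ ⟩
  (j / w * w + j % w) ∸ (j / w * w + i % w) ≡⟨ [m+n]∸[m+o]≡n∸o (j / w * w) (j % w) (i % w) ⟩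
  j % w ∸ i % w                             ≤⟨ m∸n≤m (j % w) (i % w) ⟩
  j % w                                     <⟨ m%n<n j w ⟩
  w                                         ∎
  where
  open ≤-Reasoning
  split : ∀ k → k ≡ k / w * w + k % w
  split k = trans (m≡m%n+[m/n]*n k w) (+-comm (k % w) _)

combine-injective : ∀ {m n} {i i′ : Fin m} {j j′ : Fin n} →
  combine i j ≡ combine i′ j′ → i ≡ i′ × j ≡ j′
combine-injective {n = n} {i} {i′} {j} {j′} e = cong proj₁ pairs , cong proj₂ pairs
  where
  pairs : (i , j) ≡ (i′ , j′)
  pairs = trans (sym (remQuot-combine i j)) (trans (cong (Fin.remQuot n) e) (remQuot-combine i′ j′))

-- Two points (x, y₁), (x + d, y₂) on a line x v + A w = const, where y + A = T is kept fixed,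
-- and d v > 0: the second lies q higher, with q w = d v.
slope-step : ∀ {v w d y₁ y₂ A₁ A₂} → 0 < d * v → y₁ + A₁ ≡ y₂ + A₂ → A₁ * w ≡ d * v + A₂ * w →
  Σ ℕ λ q → y₂ ≡ y₁ + q × q * w ≡ d * v
slope-step {v} {w} {d} {y₁} {y₂} {A₁} {A₂} dv>0 same-T same-line with ≤-total A₂ A₁
... | inj₁ A₂≤A₁ = q , rise , run
  where
  q : ℕ
  q = A₁ ∸ A₂
  A₁≡A₂+q : A₁ ≡ A₂ + q
  A₁≡A₂+q = sym (m+[n∸m]≡n A₂≤A₁)
  rise : y₂ ≡ y₁ + q
  rise = +-cancelʳ-≡ A₂ y₂ (y₁ + q) (begin
    y₂ + A₂       ≡⟨ same-T ⟨
    y₁ + A₁       ≡⟨ cong (y₁ +_) (trans A₁≡A₂+q (+-comm A₂ q)) ⟩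
    y₁ + (q + A₂) ≡⟨ +-assoc y₁ q A₂ ⟨
    y₁ + q + A₂   ∎)
    where open ≡-Reasoning
  run : q * w ≡ d * v
  run = +-cancelˡ-≡ (A₂ * w) _ _ (begin
    A₂ * w + q * w ≡⟨ *-distribʳ-+ w A₂ q ⟨
    (A₂ + q) * w   ≡⟨ cong (_* w) A₁≡A₂+q ⟨
    A₁ * w         ≡⟨ same-line ⟩
    d * v + A₂ * w ≡⟨ +-comm (d * v) (A₂ * w) ⟩
    A₂ * w + d * v ∎)
    where open ≡-Reasoning
... | inj₂ A₁≤A₂ = ⊥-elim (<-irrefl refl (begin-strict
  A₁ * w         ≤⟨ *-monoˡ-≤ w A₁≤A₂ ⟩
  A₂ * w         <⟨ m<n+m (A₂ * w) dv>0 ⟩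
  d * v + A₂ * w ≡⟨ same-line ⟨
  A₁ * w         ∎))
  where open ≤-Reasoning

∑ : {A : Set} → List A → (A → ℕ) → ℕ
∑ xs f = sum (map f xs)

∑-cong : {A : Set} (xs : List A) {f g : A → ℕ} → (∀ a → f a ≡ g a) → ∑ xs f ≡ ∑ xs g
∑-cong []ₗ       e = refl
∑-cong (x ∷ₗ xs) e = cong₂ _+_ (e x) (∑-cong xs e)

∑-zeros : {A : Set} (xs : List A) → ∑ xs (λ _ → 0) ≡ 0
∑-zeros []ₗ       = refl
∑-zeros (_ ∷ₗ xs) = ∑-zeros xs

∑-*ˡ : {A : Set} (xs : List A) (c : ℕ) (f : A → ℕ) → ∑ xs (λ a → c * f a) ≡ c * ∑ xs f
∑-*ˡ []ₗ       c f = sym (*-zeroʳ c)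
∑-*ˡ (x ∷ₗ xs) c f = trans (cong (c * f x +_) (∑-*ˡ xs c f)) (sym (*-distribˡ-+ c (f x) _))

∑-+ : {A : Set} (xs : List A) (f g : A → ℕ) → ∑ xs (λ a → f a + g a) ≡ ∑ xs f + ∑ xs g
∑-+ []ₗ       f g = refl
∑-+ (x ∷ₗ xs) f g = trans (cong (f x + g x +_) (∑-+ xs f g)) (interchange (f x) (g x) _ _)
  where
  interchange : ∀ a b c d → a + b + (c + d) ≡ a + c + (b + d)
  interchange = solve-∀

∑-swap : {A B : Set} (xs : List A) (ys : List B) (f : A → B → ℕ) →
  ∑ xs (λ a → ∑ ys (f a)) ≡ ∑ ys (λ b → ∑ xs (λ a → f a b))
∑-swap []ₗ       ys f = sym (∑-zeros ys)
∑-swap (x ∷ₗ xs) ys f = trans (cong (∑ ys (f x) +_) (∑-swap xs ys f))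
                              (sym (∑-+ ys (f x) (λ b → ∑ xs (λ a → f a b))))

∑-affine : {A : Set} (xs : List A) (c d e : ℕ) (f g h : A → ℕ) →
  (∀ a → c * f a ≤ d * g a + e * h a) → c * ∑ xs f ≤ d * ∑ xs g + e * ∑ xs h
∑-affine []ₗ       c d e f g h le rewrite *-zeroʳ c = z≤n
∑-affine (x ∷ₗ xs) c d e f g h le = begin
  c * (f x + ∑ xs f)                                   ≡⟨ *-distribˡ-+ c (f x) _ ⟩
  c * f x + c * ∑ xs f                                 ≤⟨ +-mono-≤ (le x) (∑-affine xs c d e f g h le) ⟩
  d * g x + e * h x + (d * ∑ xs g + e * ∑ xs h)        ≡⟨ regroup d e (g x) (h x) _ _ ⟩
  d * (g x + ∑ xs g) + e * (h x + ∑ xs h)              ∎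
  where
  open ≤-Reasoning
  regroup : ∀ d e g h G H → d * g + e * h + (d * G + e * H) ≡ d * (g + G) + e * (h + H)
  regroup = solve-∀

∑-range1 : ∀ T (f : ℕ → ℕ) → ∑ (range1 T) f ≡ ∑< T (f ∘ suc)
∑-range1 T f = trans (cong sum (sym (map-∘ (applyUpTo id T)))) (∑-applyUpTo T id)
  where
  ∑-applyUpTo : ∀ n (g : ℕ → ℕ) → ∑ (applyUpTo g n) (f ∘ suc) ≡ ∑< n (f ∘ suc ∘ g)
  ∑-applyUpTo zero    g = refl
  ∑-applyUpTo (suc n) g = cong (f (suc (g 0)) +_) (∑-applyUpTo n (g ∘ suc))

dist≤ : ∀ {x y D} → x ≤ y + D → y ≤ x + D → ∣ x - y ∣ ≤ D
dist≤ {x} {y} x≤ y≤ with ∣m-n∣≡[m∸n]∨[n∸m] x y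
... | inj₁ d≡ = subst (_≤ _) (sym d≡) (m≤n+o⇒m∸n≤o x y x≤)
... | inj₂ d≡ = subst (_≤ _) (sym d≡) (m≤n+o⇒m∸n≤o y x y≤)

weigh : ∀ c d e w x y → w ≤ 1 → (1 ≤ w → c * x ≤ d * y + e) → c * (w * x) ≤ d * (w * y) + e * w
weigh c d e zero          x y _ _  rewrite *-zeroʳ c = z≤n
weigh c d e (suc zero)    x y _ le rewrite +-identityʳ x | +-identityʳ y | *-identityʳ e = le (s≤s z≤n)
weigh c d e (suc (suc w)) x y (s≤s ()) _

module Congruence (p : ℕ) .{{_ : NonZero p}} where

  infix 4 _≡ₚ_
  _≡ₚ_ : ℕ → ℕ → Set
  x ≡ₚ y = x % p ≡ y % p

  +-congₚ : ∀ {x y u v} → x ≡ₚ y → u ≡ₚ v → x + u ≡ₚ y + v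
  +-congₚ {x} {y} {u} {v} x≡y u≡v = begin
    (x + u) % p           ≡⟨ %-distribˡ-+ x u p ⟩
    (x % p + u % p) % p   ≡⟨ cong₂ (λ s t → (s + t) % p) x≡y u≡v ⟩
    (y % p + v % p) % p   ≡⟨ %-distribˡ-+ y v p ⟨
    (y + v) % p           ∎
    where open ≡-Reasoning

  *-congˡₚ : ∀ k {x y} → x ≡ₚ y → k * x ≡ₚ k * y
  *-congˡₚ k {x} {y} x≡y = begin
    (k * x) % p             ≡⟨ %-distribˡ-* k x p ⟩
    (k % p * (x % p)) % p   ≡⟨ cong (λ s → (k % p * s) % p) x≡y ⟩
    (k % p * (y % p)) % p   ≡⟨ %-distribˡ-* k y p ⟨
    (k * y) % p             ∎
    where open ≡-Reasoning

  ≡ₚ⇒∣∸ : ∀ {x y} → y ≤ x → x ≡ₚ y → p ∣ x ∸ y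
  ≡ₚ⇒∣∸ {x} {y} y≤x x≡y = divides (x / p ∸ y / p) (begin
    x ∸ y                                    ≡⟨ cong₂ _∸_ (m≡m%n+[m/n]*n x p) (m≡m%n+[m/n]*n y p) ⟩
    (x % p + x / p * p) ∸ (y % p + y / p * p) ≡⟨ cong (λ r → (r + x / p * p) ∸ (y % p + y / p * p)) x≡y ⟩
    (y % p + x / p * p) ∸ (y % p + y / p * p) ≡⟨ [m+n]∸[m+o]≡n∸o (y % p) _ _ ⟩
    x / p * p ∸ y / p * p                    ≡⟨ *-distribʳ-∸ p (x / p) (y / p) ⟨
    (x / p ∸ y / p) * p                      ∎)
    where open ≡-Reasoning

  ∣∸⇒≡ₚ : ∀ {x y} → y ≤ x → p ∣ x ∸ y → x ≡ₚ y
  ∣∸⇒≡ₚ {x} {y} y≤x (divides k x∸y≡kp) = begin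
    x % p             ≡⟨ cong (_% p) (m+[n∸m]≡n y≤x) ⟨
    (y + (x ∸ y)) % p ≡⟨ cong (λ d → (y + d) % p) x∸y≡kp ⟩
    (y + k * p) % p   ≡⟨ [m+kn]%n≡m%n y k p ⟩
    y % p             ∎
    where open ≡-Reasoning

  ≡ₚ⇒∣dist : ∀ {x y} → x ≡ₚ y → p ∣ ∣ x - y ∣
  ≡ₚ⇒∣dist {x} {y} x≡y with ≤-total y x
  ... | inj₁ y≤x = subst (p ∣_) (sym (m≤n⇒∣n-m∣≡n∸m y≤x)) (≡ₚ⇒∣∸ y≤x x≡y)
  ... | inj₂ x≤y = subst (p ∣_) (sym (m≤n⇒∣m-n∣≡n∸m x≤y)) (≡ₚ⇒∣∸ x≤y (sym x≡y))

  ∣dist⇒≡ₚ : ∀ {x y} → p ∣ ∣ x - y ∣ → x ≡ₚ y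
  ∣dist⇒≡ₚ {x} {y} p∣d with ≤-total y x
  ... | inj₁ y≤x = ∣∸⇒≡ₚ y≤x (subst (p ∣_) (m≤n⇒∣n-m∣≡n∸m y≤x) p∣d)
  ... | inj₂ x≤y = sym (∣∸⇒≡ₚ x≤y (subst (p ∣_) (m≤n⇒∣m-n∣≡n∸m x≤y) p∣d))

  +-cancelˡₚ : ∀ c {x y} → c + x ≡ₚ c + y → x ≡ₚ y
  +-cancelˡₚ c {x} {y} e = ∣dist⇒≡ₚ (subst (p ∣_) (∣m+n-m+o∣≡∣n-o∣ c x y) (≡ₚ⇒∣dist e))

  *-cancelˡₚ : Prime p → ∀ {c x y} → ¬ p ∣ c → c * x ≡ₚ c * y → x ≡ₚ y
  *-cancelˡₚ p-prime {c} {x} {y} p∤c e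
    with euclidsLemma c ∣ x - y ∣ p-prime (subst (p ∣_) (sym (*-distribˡ-∣-∣ c x y)) (≡ₚ⇒∣dist e))
  ... | inj₁ p∣c = ⊥-elim (p∤c p∣c)
  ... | inj₂ p∣d = ∣dist⇒≡ₚ p∣d

  ≡ₚ⇒≡ : ∀ {x y} → x < p → y < p → x ≡ₚ y → x ≡ y
  ≡ₚ⇒≡ x<p y<p e = trans (sym (m<n⇒m%n≡m x<p)) (trans e (m<n⇒m%n≡m y<p))

module Lattice (p : ℕ) .{{_ : NonZero p}} (a b : ℕ) where
  open Congruence p

  L : ℕ → ℕ → Set
  L x y = x * a ≡ₚ y * b

  -- the membership indicator; it is literally the last factor of the summand of J
  ind : ℕ → ℕ → ℕ
  ind x y = 𝟙 ((x * a) % p ≟ (y * b) % p)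

  ind≤1 : ∀ x y → ind x y ≤ 1
  ind≤1 x y = 𝟙≤1 ((x * a) % p ≟ (y * b) % p)

  ind-sound : ∀ x y → 1 ≤ ind x y → L x y
  ind-sound x y = 𝟙-sound ((x * a) % p ≟ (y * b) % p)

  ind-complete : ∀ x y → L x y → ind x y ≡ 1
  ind-complete x y = 𝟙-complete ((x * a) % p ≟ (y * b) % p)

  -- row T i counts the points (i + 1, y) with y ∈ [1, T]; N T counts the points in [1, T]²
  row : ℕ → ℕ → ℕ
  row T i = ∑< T (λ j → ind (suc i) (suc j))

  N : ℕ → ℕ
  N T = ∑< T (row T)

  L-scale : ∀ k {x y} → L x y → L (k * x) (k * y)
  L-scale k {x} {y} l = begin
    (k * x * a) % p   ≡⟨ cong (_% p) (*-assoc k x a) ⟩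
    (k * (x * a)) % p ≡⟨ *-congˡₚ k l ⟩
    (k * (y * b)) % p ≡⟨ cong (_% p) (*-assoc k y b) ⟨
    (k * y * b) % p   ∎
    where open ≡-Reasoning

  L-sub : ∀ {x₁ y₁ x₂ y₂} → x₁ ≤ x₂ → y₁ ≤ y₂ → L x₁ y₁ → L x₂ y₂ → L (x₂ ∸ x₁) (y₂ ∸ y₁)
  L-sub {x₁} {y₁} {x₂} {y₂} x₁≤x₂ y₁≤y₂ l₁ l₂ = +-cancelˡₚ (y₁ * b) (begin
    (y₁ * b + (x₂ ∸ x₁) * a) % p ≡⟨ +-congₚ (sym l₁) refl ⟩
    (x₁ * a + (x₂ ∸ x₁) * a) % p ≡⟨ cong (_% p) (recombine a x₁≤x₂) ⟩
    (x₂ * a) % p                 ≡⟨ l₂ ⟩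
    (y₂ * b) % p                 ≡⟨ cong (_% p) (recombine b y₁≤y₂) ⟨
    (y₁ * b + (y₂ ∸ y₁) * b) % p ∎)
    where
    open ≡-Reasoning
    recombine : ∀ c {s t} → s ≤ t → s * c + (t ∸ s) * c ≡ t * c
    recombine c {s} s≤t = trans (sym (*-distribʳ-+ c s _)) (cong (_* c) (m+[n∸m]≡n s≤t))

  L-unique : Prime p → ¬ p ∣ b → ∀ {x y₁ y₂} → y₁ < p → y₂ < p → L x y₁ → L x y₂ → y₁ ≡ y₂
  L-unique p-prime b-unit {x} {y₁} {y₂} y₁<p y₂<p l₁ l₂ = ≡ₚ⇒≡ y₁<p y₂<p
    (*-cancelˡₚ p-prime b-unit (subst₂ _≡ₚ_ (*-comm y₁ b) (*-comm y₂ b) (trans (sym l₁) l₂)))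

  row≤1 : Prime p → ¬ p ∣ b → ∀ {T} → T < p → ∀ i → row T i ≤ 1
  row≤1 p-prime b-unit {T} T<p i =
    count-by-code T (λ j → ind (suc i) (suc j)) (λ j → ind≤1 (suc i) (suc j)) (λ _ _ _ → Fin.zero)
      (λ j₁ j₂ j₁<T j₂<T χ₁ χ₂ _ → same-column j₁ j₂ j₁<T j₂<T χ₁ χ₂)
    where
    same-column : ∀ j₁ j₂ → j₁ < T → j₂ < T →
      1 ≤ ind (suc i) (suc j₁) → 1 ≤ ind (suc i) (suc j₂) → j₁ ≡ j₂
    same-column j₁ j₂ j₁<T j₂<T χ₁ χ₂ = suc-injective (L-unique p-prime b-unit {suc i}
      (≤-<-trans j₁<T T<p) (≤-<-trans j₂<T T<p)
      (ind-sound (suc i) (suc j₁) χ₁) (ind-sound (suc i) (suc j₂) χ₂))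

  point⇒row : ∀ {T} i j → j < T → L (suc i) (suc j) → 1 ≤ row T i
  point⇒row {T} i j j<T l =
    ≤-trans (≤-reflexive (sym (ind-complete (suc i) (suc j) l)))
            (term≤∑< T (λ j → ind (suc i) (suc j)) j<T)

  point⇒N : ∀ {T} i j → i < T → j < T → L (suc i) (suc j) → 1 ≤ N T
  point⇒N {T} i j i<T j<T l = ≤-trans (point⇒row i j j<T l) (term≤∑< T (row T) i<T)

  N⇒point : ∀ {T} → 1 ≤ N T → Σ ℕ λ i → Σ ℕ λ j → i < T × j < T × L (suc i) (suc j)
  N⇒point {T} pos =
    i , j , proj₁ row-i , proj₁ point-ij , ind-sound (suc i) (suc j) (proj₂ point-ij)
    where
    i : ℕ
    i = firstPos (row T) T
    row-i : i < T × 1 ≤ row T i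
    row-i = firstPos-spec (row T) T pos
    j : ℕ
    j = firstPos (λ j → ind (suc i) (suc j)) T
    point-ij : j < T × 1 ≤ ind (suc i) (suc j)
    point-ij = firstPos-spec (λ j → ind (suc i) (suc j)) T (proj₂ row-i)

  least-box : ∀ s → 1 ≤ N s → Σ ℕ λ w → 1 ≤ N (suc w) × ¬ 1 ≤ N w
  least-box zero    ()
  least-box (suc s) pos with 1 ≤? N s
  ... | yes pos' = least-box s pos'
  ... | no empty = s , pos , empty

  record ShortVector : Set where
    field
      w v   : ℕ
      v-pos : 1 ≤ v
      v≤w   : v ≤ w
      on-L  : L w v
      gap   : ∀ {x y} → 1 ≤ x → 1 ≤ y → x < w → y < w → ¬ L x y

  -- Given a short vector, N T is about T / w: the rows of the multiples of (w, v) give a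
  -- lower bound, and the lines parallel to (w, v), spaced p apart, give an upper bound.
  module ShortVectorBounds (S : ShortVector) where
    open ShortVector S

    w-pos : 1 ≤ w
    w-pos = ≤-trans v-pos v≤w

    instance
      w-nonZero : NonZero w
      w-nonZero = >-nonZero w-pos

    N-below-gap : ∀ {T} → T < w → N T ≡ 0
    N-below-gap {T} T<w = n<1⇒n≡0 (≰⇒> empty)
      where
      empty : ¬ 1 ≤ N T
      empty pos with i , j , i<T , j<T , l ← N⇒point pos =
        gap (s≤s z≤n) (s≤s z≤n) (≤-<-trans i<T T<w) (≤-<-trans j<T T<w) l

    -- The multiple k (w, v) lies in row k w − 1, so each block of w rows is non-empty.
    multiples : ∀ {T} k → k * w ≤ T → k ≤ ∑< (k * w) (row T)
    multiples     zero    _    = z≤n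
    multiples {T} (suc k) kw≤T = begin
      1 + k
        ≤⟨ +-mono-≤ last-block (multiples k (≤-trans (m≤n+m (k * w) w) kw≤T)) ⟩
      ∑< w block + ∑< (k * w) (row T)
        ≡⟨ +-comm (∑< w block) (∑< (k * w) (row T)) ⟩
      ∑< (k * w) (row T) + ∑< w block
        ≡⟨ ∑<-split (k * w) w (row T) ⟨
      ∑< (k * w + w) (row T)
        ≡⟨ cong (λ n → ∑< n (row T)) (+-comm (k * w) w) ⟩
      ∑< (suc k * w) (row T)
        ∎
      where
      open ≤-Reasoning
      -- the rows k w, …, k w + w − 1, i.e. x ∈ [k w + 1, (k + 1) w]
      block : ℕ → ℕ
      block i = row T (k * w + i)
      y : ℕ
      y = suc k * v
      x≡ : suc (k * w + pred w) ≡ suc k * w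
      x≡ = trans (sym (+-suc (k * w) (pred w))) (trans (cong (k * w +_) (suc-pred w)) (+-comm (k * w) w))
      y≡ : suc (pred y) ≡ y
      y≡ = suc-pred y {{>-nonZero (*-mono-≤ (s≤s (z≤n {k})) v-pos)}}
      y-1<T : pred y < T
      y-1<T = subst (_≤ T) (sym y≡) (≤-trans (*-monoʳ-≤ (suc k) v≤w) kw≤T)
      multiple : L (suc (k * w + pred w)) (suc (pred y))
      multiple = subst₂ L (sym x≡) (sym y≡) (L-scale (suc k) {w} {v} on-L)
      last-block : 1 ≤ ∑< w block
      last-block = ≤-trans (point⇒row (k * w + pred w) (pred y) y-1<T multiple)
                           (term≤∑< w block (≤-reflexive (suc-pred w)))

    lower : ∀ T → T ≤ w * N T + w
    lower T = begin
      T                 ≡⟨ m≡m%n+[m/n]*n T w ⟩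
      T % w + T / w * w ≤⟨ +-mono-≤ (<⇒≤ (m%n<n T w)) (*-monoˡ-≤ w blocks) ⟩
      w + N T * w       ≡⟨ trans (+-comm w _) (cong (_+ w) (*-comm (N T) w)) ⟩
      w * N T + w       ∎
      where
      open ≤-Reasoning
      blocks : T / w ≤ N T
      blocks = ≤-trans (multiples (T / w) (m/n*n≤m T w)) (∑<-prefix (row T) (m/n*n≤m T w))

    -- For T < p each row holds at most one lattice point.  Rows are grouped into blocks of
    -- w, and points by their line x v + (T − y) w = h parallel to (w, v); the heights h of
    -- lattice points are congruent mod p, so a block and the quotient h / p determine a row.
    module Upper (p-prime : Prime p) (a-unit : ¬ p ∣ a) (b-unit : ¬ p ∣ b) (T : ℕ) (T<p : T < p) where

      height : ℕ → ℕ → ℕ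
      height x y = x * v + (T ∸ y) * w

      height-invariant : ∀ {x y} → y ≤ T → L x y → a * height x y ≡ₚ T * v * b
      height-invariant {x} {y} y≤T l = begin
        (a * (x * v + (T ∸ y) * w)) % p        ≡⟨ cong (_% p) (regroup a x v (T ∸ y) w) ⟩
        (v * (x * a) + (T ∸ y) * (w * a)) % p   ≡⟨ +-congₚ (*-congˡₚ v l) (*-congˡₚ (T ∸ y) on-L) ⟩
        (v * (y * b) + (T ∸ y) * (v * b)) % p   ≡⟨ cong (_% p) (collect v y b (T ∸ y)) ⟩
        ((y + (T ∸ y)) * v * b) % p             ≡⟨ cong (λ t → (t * v * b) % p) (m+[n∸m]≡n y≤T) ⟩
        (T * v * b) % p                         ∎
        where
        open ≡-Reasoning
        regroup : ∀ a x v t w → a * (x * v + t * w) ≡ v * (x * a) + t * (w * a)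
        regroup = solve-∀
        collect : ∀ v y b t → v * (y * b) + t * (v * b) ≡ (y + t) * v * b
        collect = solve-∀

      height-congruent : ∀ {x₁ y₁ x₂ y₂} → y₁ ≤ T → y₂ ≤ T → L x₁ y₁ → L x₂ y₂ →
        height x₁ y₁ ≡ₚ height x₂ y₂
      height-congruent {x₁} {y₁} {x₂} {y₂} y₁≤T y₂≤T l₁ l₂ = *-cancelˡₚ p-prime a-unit
        (trans (height-invariant {x₁} y₁≤T l₁) (sym (height-invariant {x₂} y₂≤T l₂)))

      -- Distinct lattice points on a common line are at least w apart horizontally,
      -- for otherwise their difference would be a lattice point in the gap [1, w)².
      same-line⇒far : ∀ {x₁ y₁ x₂ y₂} → x₁ < x₂ → y₁ ≤ T → y₂ ≤ T → L x₁ y₁ → L x₂ y₂ →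
        height x₁ y₁ ≡ height x₂ y₂ → w ≤ x₂ ∸ x₁
      same-line⇒far {x₁} {y₁} {x₂} {y₂} x₁<x₂ y₁≤T y₂≤T l₁ l₂ same-height with w ≤? x₂ ∸ x₁
      ... | yes far = far
      ... | no near = ⊥-elim (gap d>0 q>0 (≰⇒> near) q<w difference)
        where
        d : ℕ
        d = x₂ ∸ x₁
        d>0 : 0 < d
        d>0 = m<n⇒0<n∸m x₁<x₂
        dv>0 : 0 < d * v
        dv>0 = *-mono-≤ d>0 v-pos
        x₂≡ : x₂ ≡ x₁ + d
        x₂≡ = sym (m+[n∸m]≡n (<⇒≤ x₁<x₂))
        same-T : y₁ + (T ∸ y₁) ≡ y₂ + (T ∸ y₂)
        same-T = trans (m+[n∸m]≡n y₁≤T) (sym (m+[n∸m]≡n y₂≤T))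
        same-line : (T ∸ y₁) * w ≡ d * v + (T ∸ y₂) * w
        same-line = +-cancelˡ-≡ (x₁ * v) _ _ (begin
          x₁ * v + (T ∸ y₁) * w         ≡⟨ same-height ⟩
          x₂ * v + (T ∸ y₂) * w         ≡⟨ cong (λ x → x * v + (T ∸ y₂) * w) x₂≡ ⟩
          (x₁ + d) * v + (T ∸ y₂) * w   ≡⟨ cong (_+ (T ∸ y₂) * w) (*-distribʳ-+ v x₁ d) ⟩
          x₁ * v + d * v + (T ∸ y₂) * w ≡⟨ +-assoc (x₁ * v) (d * v) _ ⟩
          x₁ * v + (d * v + (T ∸ y₂) * w) ∎)
          where open ≡-Reasoning
        step : Σ ℕ λ q → y₂ ≡ y₁ + q × q * w ≡ d * v
        step = slope-step {v} {w} {d} dv>0 same-T same-line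
        q : ℕ
        q = proj₁ step
        rise : y₂ ≡ y₁ + q
        rise = proj₁ (proj₂ step)
        run : q * w ≡ d * v
        run = proj₂ (proj₂ step)
        q>0 : 0 < q
        q>0 = *-cancelʳ-< w 0 q (subst (0 <_) (sym run) dv>0)
        q≤d : q ≤ d
        q≤d = *-cancelʳ-≤ q d w (subst (_≤ d * w) (sym run) (*-monoʳ-≤ d v≤w))
        q<w : q < w
        q<w = ≤-<-trans q≤d (≰⇒> near)
        difference : L d q
        difference = subst (L d) (trans (cong (_∸ y₁) rise) (m+n∸m≡n y₁ q))
          (L-sub (<⇒≤ x₁<x₂) (subst (y₁ ≤_) (sym rise) (m≤m+n y₁ q)) l₁ l₂)

      col : ℕ → ℕ
      col i = firstPos (λ j → ind (suc i) (suc j)) T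

      col-spec : ∀ i → 1 ≤ row T i → col i < T × L (suc i) (suc (col i))
      col-spec i pos with col<T , point ← firstPos-spec (λ j → ind (suc i) (suc j)) T pos =
        col<T , ind-sound (suc i) (suc (col i)) point

      level : ℕ → ℕ
      level i = height (suc i) (suc (col i))

      level-congruent : ∀ i j → 1 ≤ row T i → 1 ≤ row T j → level i ≡ₚ level j
      level-congruent i j ri rj = height-congruent {suc i} {suc (col i)} {suc j} {suc (col j)}
        (proj₁ (col-spec i ri)) (proj₁ (col-spec j rj))
        (proj₂ (col-spec i ri)) (proj₂ (col-spec j rj))

      E : ℕ
      E = T * w + T * w

      level≤E : ∀ i → i < T → level i ≤ E
      level≤E i i<T = +-mono-≤ (*-mono-≤ i<T v≤w) (*-monoˡ-≤ w (m∸n≤m T (suc (col i))))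

      -- number of blocks of w rows minus one, and number of possible values of level / p
      W B : ℕ
      W = pred T / w
      B = suc (E / p)

      code : ∀ i → i < T → 1 ≤ row T i → Fin (suc W * B)
      code i i<T _ = combine (fromℕ< (s≤s (/-monoˡ-≤ w (<⇒≤pred i<T))))
                             (fromℕ< (s≤s (/-monoˡ-≤ p (level≤E i i<T))))

      same-block-and-line : ∀ i j → i < T → j < T → 1 ≤ row T i → 1 ≤ row T j →
        i / w ≡ j / w → level i ≡ level j → i ≡ j
      same-block-and-line i j i<T j<T ri rj same-w same-h with <-cmp i j
      ... | tri≈ _ i≡j _ = i≡j
      ... | tri< i<j _ _ = ⊥-elim (<⇒≱ (same-block i j w same-w)
              (same-line⇒far (s≤s i<j) (proj₁ (col-spec i ri)) (proj₁ (col-spec j rj))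
                 (proj₂ (col-spec i ri)) (proj₂ (col-spec j rj)) same-h))
      ... | tri> _ _ j<i = ⊥-elim (<⇒≱ (same-block j i w (sym same-w))
              (same-line⇒far (s≤s j<i) (proj₁ (col-spec j rj)) (proj₁ (col-spec i ri))
                 (proj₂ (col-spec j rj)) (proj₂ (col-spec i ri)) (sym same-h)))

      code-injective : ∀ i j (i<T : i < T) (j<T : j < T) ri rj →
        code i i<T ri ≡ code j j<T rj → i ≡ j
      code-injective i j i<T j<T ri rj e with same-w , same-q ← combine-injective e =
        same-block-and-line i j i<T j<T ri rj
          (fromℕ<-injective _ _ _ _ same-w)
          (divmod-≡ p (fromℕ<-injective _ _ _ _ same-q) (level-congruent i j ri rj))

      N≤codes : N T ≤ suc W * B
      N≤codes = count-by-code T (row T) (row≤1 p-prime b-unit T<p) code code-injective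

      upper : p * w * N T ≤ (T + w) * (E + p)
      upper = begin
        p * w * N T           ≤⟨ *-monoʳ-≤ (p * w) N≤codes ⟩
        p * w * (suc W * B)   ≡⟨ regroup p w (suc W) B ⟩
        (suc W * w) * (p * B) ≤⟨ *-mono-≤ blocks levels ⟩
        (T + w) * (E + p)     ∎
        where
        open ≤-Reasoning
        regroup : ∀ p w c B → p * w * (c * B) ≡ (c * w) * (p * B)
        regroup = solve-∀
        blocks : suc W * w ≤ T + w
        blocks = subst (_≤ T + w) (+-comm (W * w) w)
          (+-monoˡ-≤ w (≤-trans (m/n*n≤m (pred T) w) pred[n]≤n))
        levels : p * B ≤ E + p
        levels = begin
          p * suc (E / p)   ≡⟨ *-suc p (E / p) ⟩
          p + p * (E / p)   ≡⟨ cong (p +_) (*-comm p (E / p)) ⟩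
          p + E / p * p     ≤⟨ +-monoʳ-≤ p (m/n*n≤m E p) ⟩
          p + E             ≡⟨ +-comm p E ⟩
          E + p             ∎

-- Transposing the lattice: (x, y) ∈ L(b, a) iff (y, x) ∈ L(a, b), so both count the same points.
N-transpose : ∀ p .{{_ : NonZero p}} a b T → Lattice.N p b a T ≡ Lattice.N p a b T
N-transpose p a b T = trans
  (∑<-cong T (λ i _ → ∑<-cong T (λ j _ →
     𝟙-cong sym sym ((suc i * b) % p ≟ (suc j * a) % p) ((suc j * a) % p ≟ (suc i * b) % p))))
  (∑<-swap T T (λ i j → Lattice.ind p a b (suc j) (suc i)))

unit : ∀ {p a} .{{_ : NonZero p}} → 1 ≤ a → a < p → ¬ p ∣ a
unit a-pos a<p p∣a = <⇒≱ a<p (∣⇒≤ {{>-nonZero a-pos}} p∣a)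

-- Every lattice L(a, b) with a, b ≥ 1 has a short vector, possibly after transposition:
-- take the smallest box [1, w]² containing a lattice point; such a point has a
-- coordinate equal to w, and no lattice point lies in [1, w)².
short-vector : ∀ p .{{_ : NonZero p}} a b → 1 ≤ a → 1 ≤ b →
  Lattice.ShortVector p a b ⊎ Lattice.ShortVector p b a
short-vector p a@(suc a′) b@(suc b′) _ _ = from-box (least-box (b + a) (point⇒N b′ a′ b′<b+a a′<b+a ba∈L))
  where
  open Lattice p a b
  module Lᵀ = Lattice p b a
  b′<b+a : b′ < b + a
  b′<b+a = m≤m+n b a
  a′<b+a : a′ < b + a
  a′<b+a = m≤n+m a b
  ba∈L : L b a
  ba∈L = cong (_% p) (*-comm b a)
  from-box : (Σ ℕ λ w → 1 ≤ N (suc w) × ¬ 1 ≤ N w) → ShortVector ⊎ Lᵀ.ShortVector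
  from-box (w , nonempty , empty) = from-point (N⇒point nonempty)
    where
    gap : ∀ {x y} → 1 ≤ x → 1 ≤ y → x < suc w → y < suc w → ¬ L x y
    gap {suc x} {suc y} _ _ x<w y<w l = empty (point⇒N x y (≤-pred x<w) (≤-pred y<w) l)
    from-point : (Σ ℕ λ i → Σ ℕ λ j → i < suc w × j < suc w × L (suc i) (suc j)) →
      ShortVector ⊎ Lᵀ.ShortVector
    from-point (i , j , i<w , j<w , l) with m≤n⇒m<n∨m≡n (≤-pred i<w) | m≤n⇒m<n∨m≡n (≤-pred j<w)
    ... | inj₂ refl | _ = inj₁ (record
      { w = suc w ; v = suc j ; v-pos = s≤s z≤n ; v≤w = j<w ; on-L = l ; gap = gap })
    ... | inj₁ _ | inj₂ refl = inj₂ (record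
      { w = suc w ; v = suc i ; v-pos = s≤s z≤n ; v≤w = i<w ; on-L = sym l
      ; gap = λ x-pos y-pos x<w y<w l′ → gap y-pos x-pos y<w x<w (sym l′) })
    ... | inj₁ i<w′ | inj₁ j<w′ = ⊥-elim (empty (point⇒N i j i<w′ j<w′ l))

balance : ∀ p w H K N_H N_K → 1 ≤ w → w ≤ H →
  p * w * N_H ≤ (H + w) * (H * w + H * w + p) → K ≤ w * N_K + w →
  p * K * N_H ≤ p * H * N_K + 4 * (H + K) * (H * K + p)
balance p w H K N_H N_K w-pos w≤H upper lower = *-cancelˡ-≤ w {{>-nonZero w-pos}} (begin
  w * (p * K * N_H)
    ≡⟨ r₁ w p K N_H ⟩
  K * (p * w * N_H)
    ≤⟨ *-monoʳ-≤ K upper ⟩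
  K * ((H + w) * (H * w + H * w + p))
    ≡⟨ r₂ K H w p ⟩
  p * H * K + w * (2 * K * H * H + 2 * K * H * w + K * p)
    ≤⟨ +-mono-≤ (*-monoʳ-≤ (p * H) lower) (*-monoʳ-≤ w w≤H-terms) ⟩
  p * H * (w * N_K + w) + w * (2 * K * H * H + 2 * K * H * H + K * p)
    ≡⟨ r₃ p H w N_K K ⟩
  w * (p * H * N_K + (p * H + 4 * K * H * H + K * p))
    ≤⟨ *-monoʳ-≤ w (+-monoʳ-≤ (p * H * N_K) slack) ⟩
  w * (p * H * N_K + 4 * (H + K) * (H * K + p))
    ∎)
  where
  open ≤-Reasoning
  r₁ : ∀ w p K N → w * (p * K * N) ≡ K * (p * w * N)
  r₁ = solve-∀
  r₂ : ∀ K H w p → K * ((H + w) * (H * w + H * w + p))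
                   ≡ p * H * K + w * (2 * K * H * H + 2 * K * H * w + K * p)
  r₂ = solve-∀
  r₃ : ∀ p H w N K → p * H * (w * N + w) + w * (2 * K * H * H + 2 * K * H * H + K * p)
                     ≡ w * (p * H * N + (p * H + 4 * K * H * H + K * p))
  r₃ = solve-∀
  w≤H-terms : 2 * K * H * H + 2 * K * H * w + K * p ≤ 2 * K * H * H + 2 * K * H * H + K * p
  w≤H-terms = +-monoˡ-≤ (K * p) (+-monoʳ-≤ (2 * K * H * H) (*-monoʳ-≤ (2 * K * H) w≤H))
  slack : p * H + 4 * K * H * H + K * p ≤ 4 * (H + K) * (H * K + p)
  slack = subst (p * H + 4 * K * H * H + K * p ≤_) (r₄ p H K)
                (m≤m+n _ (3 * (p * H) + 4 * H * K * K + 3 * (K * p)))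
    where
    r₄ : ∀ p H K → p * H + 4 * K * H * H + K * p + (3 * (p * H) + 4 * H * K * K + 3 * (K * p))
                   ≡ 4 * (H + K) * (H * K + p)
    r₄ = solve-∀

module _ (p : ℕ) .{{_ : NonZero p}} (p-prime : Prime p) where

  -- from a short vector (w, v): trivial if H < w (no points), else combine the bounds
  balanced-by-short-vector : ∀ {a b} → ¬ p ∣ a → ¬ p ∣ b → (S : Lattice.ShortVector p a b) →
    ∀ H K → H < p →
    p * K * Lattice.N p a b H ≤ p * H * Lattice.N p a b K + 4 * (H + K) * (H * K + p)
  balanced-by-short-vector {a} {b} a-unit b-unit S H K H<p with H <? Lattice.ShortVector.w S
  ... | yes H<w rewrite Lattice.ShortVectorBounds.N-below-gap p a b S H<w | *-zeroʳ (p * K) = z≤n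
  ... | no w≰H = balance p w H K (N H) (N K) w-pos (≮⇒≥ w≰H)
                   (Upper.upper p-prime a-unit b-unit H H<p) (lower K)
    where
    open Lattice p a b
    open ShortVector S using (w)
    open ShortVectorBounds S

  pair-bound : ∀ a b → 1 ≤ a → a < p → 1 ≤ b → b < p → ∀ H K → H < p →
    p * K * Lattice.N p a b H ≤ p * H * Lattice.N p a b K + 4 * (H + K) * (H * K + p)
  pair-bound a b a-pos a<p b-pos b<p H K H<p with short-vector p a b a-pos b-pos
  ... | inj₁ S = balanced-by-short-vector (unit a-pos a<p) (unit b-pos b<p) S H K H<p
  ... | inj₂ S = subst₂ (λ N_H N_K → p * K * N_H ≤ p * H * N_K + 4 * (H + K) * (H * K + p))
                   (N-transpose p a b H) (N-transpose p a b K)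
                   (balanced-by-short-vector (unit b-pos b<p) (unit a-pos a<p) S H K H<p)

module Decomposition (p : ℕ) .{{_ : NonZero p}} (𝓜 : Subset p) where

  χ : Fin p → ℕ
  χ m = 𝟙 (m ∈? 𝓜)

  ∑χ≡∣𝓜∣ : ∑ (allFin p) χ ≡ ∣ 𝓜 ∣
  ∑χ≡∣𝓜∣ = trans (cong sum (map-tabulate id χ)) (count 𝓜)
    where
    count : ∀ {n} (S : Subset n) → sum (tabulate (λ m → 𝟙 (m ∈? S))) ≡ ∣ S ∣
    count []            = refl
    count (inside ∷ S)  = cong suc (count S)
    count (outside ∷ S) = count S

  N : Fin p → Fin p → ℕ → ℕ
  N m n = Lattice.N p (toℕ m) (toℕ n)

  J-decomposition : ∀ T → J p 𝓜 T ≡ ∑ (allFin p) (λ m → ∑ (allFin p) (λ n → χ m * χ n * N m n T))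
  J-decomposition T = begin
    J p 𝓜 T
      ≡⟨ ∑-cong R (λ x → ∑-swap R F (λ y m → ∑ F (G x y m))) ⟩
    ∑ R (λ x → ∑ F (λ m → ∑ R (λ y → ∑ F (G x y m))))
      ≡⟨ ∑-cong R (λ x → ∑-cong F (λ m → ∑-swap R F (λ y → G x y m))) ⟩
    ∑ R (λ x → ∑ F (λ m → ∑ F (λ n → ∑ R (λ y → G x y m n))))
      ≡⟨ ∑-swap R F (λ x m → ∑ F (λ n → ∑ R (λ y → G x y m n))) ⟩
    ∑ F (λ m → ∑ R (λ x → ∑ F (λ n → ∑ R (λ y → G x y m n))))
      ≡⟨ ∑-cong F (λ m → ∑-swap R F (λ x n → ∑ R (λ y → G x y m n))) ⟩
    ∑ F (λ m → ∑ F (λ n → ∑ R (λ x → ∑ R (λ y → G x y m n))))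
      ≡⟨ ∑-cong F (λ m → ∑-cong F (λ n → weight-out m n)) ⟩
    ∑ F (λ m → ∑ F (λ n → χ m * χ n * N m n T))
      ∎
    where
    open ≡-Reasoning
    R : List ℕ
    R = range1 T
    F : List (Fin p)
    F = allFin p
    G : ℕ → ℕ → Fin p → Fin p → ℕ
    G x y m n = bit (does (m ∈? 𝓜) ∧ does (n ∈? 𝓜) ∧ does ((x * toℕ m) % p ≟ (y * toℕ n) % p))
    G-factors : ∀ x y m n → G x y m n ≡ χ m * χ n * Lattice.ind p (toℕ m) (toℕ n) x y
    G-factors x y m n = trans (bit-∧ (does (m ∈? 𝓜)) _)
      (trans (cong (χ m *_) (bit-∧ (does (n ∈? 𝓜)) _)) (sym (*-assoc (χ m) (χ n) _)))
    weight-out : ∀ m n → ∑ R (λ x → ∑ R (λ y → G x y m n)) ≡ χ m * χ n * N m n T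
    weight-out m n = begin
      ∑ R (λ x → ∑ R (λ y → G x y m n))
        ≡⟨ ∑-cong R (λ x → trans (∑-cong R (λ y → G-factors x y m n)) (∑-*ˡ R c (ind x))) ⟩
      ∑ R (λ x → c * ∑ R (ind x))
        ≡⟨ ∑-*ˡ R c (λ x → ∑ R (ind x)) ⟩
      c * ∑ R (λ x → ∑ R (ind x))
        ≡⟨ cong (c *_) (trans (∑-range1 T _) (∑<-cong T (λ i _ → ∑-range1 T _))) ⟩
      c * N m n T
        ∎
      where
      c : ℕ
      c = χ m * χ n
      ind : ℕ → ℕ → ℕ
      ind = Lattice.ind p (toℕ m) (toℕ n)

module Summation (p : ℕ) .{{_ : NonZero p}} (p-prime : Prime p) (𝓜 : Subset p)
                 (𝓜-nonzero : ∀ m → m ∈ 𝓜 → toℕ m ≢ 0) where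
  open Decomposition p 𝓜

  bound : ℕ → ℕ → ℕ
  bound H K = 4 * ((H + K) * (H * K + p) * ∣ 𝓜 ∣ ^ 2)

  weights : ∑ (allFin p) (λ m → ∑ (allFin p) (λ n → χ m * χ n)) ≡ ∣ 𝓜 ∣ * ∣ 𝓜 ∣
  weights = begin
    ∑ F (λ m → ∑ F (λ n → χ m * χ n)) ≡⟨ ∑-cong F (λ m → ∑-*ˡ F (χ m) χ) ⟩
    ∑ F (λ m → χ m * ∑ F χ)           ≡⟨ ∑-cong F (λ m → cong (χ m *_) ∑χ≡∣𝓜∣) ⟩
    ∑ F (λ m → χ m * ∣ 𝓜 ∣)           ≡⟨ ∑-cong F (λ m → *-comm (χ m) ∣ 𝓜 ∣) ⟩
    ∑ F (λ m → ∣ 𝓜 ∣ * χ m)           ≡⟨ ∑-*ˡ F ∣ 𝓜 ∣ χ ⟩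
    ∣ 𝓜 ∣ * ∑ F χ                     ≡⟨ cong (∣ 𝓜 ∣ *_) ∑χ≡∣𝓜∣ ⟩
    ∣ 𝓜 ∣ * ∣ 𝓜 ∣                     ∎
    where
    open ≡-Reasoning
    F : List (Fin p)
    F = allFin p

  one-sided : ∀ H K → H < p → p * (K * J p 𝓜 H) ≤ p * (H * J p 𝓜 K) + bound H K
  one-sided H K H<p = begin
    p * (K * J p 𝓜 H)
      ≡⟨ sym (*-assoc p K _) ⟩
    p * K * J p 𝓜 H
      ≡⟨ cong (p * K *_) (J-decomposition H) ⟩
    p * K * ∑ F (λ m → ∑ F (λ n → χ m * χ n * N m n H))
      ≤⟨ ∑-affine F (p * K) (p * H) C _ _ _ (λ m → ∑-affine F (p * K) (p * H) C _ _ _ (weighted m)) ⟩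
    p * H * ∑ F (λ m → ∑ F (λ n → χ m * χ n * N m n K)) + C * ∑ F (λ m → ∑ F (λ n → χ m * χ n))
      ≡⟨ cong₂ (λ s t → p * H * s + C * t) (sym (J-decomposition K)) weights ⟩
    p * H * J p 𝓜 K + C * (∣ 𝓜 ∣ * ∣ 𝓜 ∣)
      ≡⟨ cong₂ _+_ (*-assoc p H _) C|𝓜|²≡bound ⟩
    p * (H * J p 𝓜 K) + bound H K
      ∎
    where
    open ≤-Reasoning
    F : List (Fin p)
    F = allFin p
    C : ℕ
    C = 4 * (H + K) * (H * K + p)
    C|𝓜|²≡bound : C * (∣ 𝓜 ∣ * ∣ 𝓜 ∣) ≡ bound H K
    C|𝓜|²≡bound = trans (regroup H K p ∣ 𝓜 ∣) (cong (λ s → 4 * ((H + K) * (H * K + p) * s)) square)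
      where
      regroup : ∀ H K p S → 4 * (H + K) * (H * K + p) * (S * S) ≡ 4 * ((H + K) * (H * K + p) * (S * S))
      regroup = solve-∀
      square : ∣ 𝓜 ∣ * ∣ 𝓜 ∣ ≡ ∣ 𝓜 ∣ ^ 2
      square = cong (∣ 𝓜 ∣ *_) (sym (*-identityʳ ∣ 𝓜 ∣))
    pair : ∀ m n → 1 ≤ χ m * χ n → p * K * N m n H ≤ p * H * N m n K + C
    pair m n both with m ∈? 𝓜 | n ∈? 𝓜
    ... | yes m∈𝓜 | yes n∈𝓜 = pair-bound p p-prime (toℕ m) (toℕ n)
      (n≢0⇒n>0 (𝓜-nonzero m m∈𝓜)) (toℕ<n m) (n≢0⇒n>0 (𝓜-nonzero n n∈𝓜)) (toℕ<n n) H K H<p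
    pair m n () | yes _ | no _
    pair m n () | no _  | _
    weighted : ∀ m n → p * K * (χ m * χ n * N m n H) ≤ p * H * (χ m * χ n * N m n K) + C * (χ m * χ n)
    weighted m n = weigh (p * K) (p * H) C (χ m * χ n) (N m n H) (N m n K)
      (*-mono-≤ (𝟙≤1 (m ∈? 𝓜)) (𝟙≤1 (n ∈? 𝓜))) (pair m n)

  bound-sym : ∀ H K → bound K H ≡ bound H K
  bound-sym H K = cong (λ t → 4 * (t * ∣ 𝓜 ∣ ^ 2)) (swap H K p)
    where
    swap : ∀ H K p → (K + H) * (K * H + p) ≡ (H + K) * (H * K + p)
    swap = solve-∀

lemma3p2 : Σ ℕ λ c →
    (p : ℕ) .{{_ : NonZero p}} → Prime p →
    (𝓜 : Subset p) → (∀ m → m ∈ 𝓜 → toℕ m ≢ 0) →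
    (H K : ℕ) → 1 ≤ H → H < p → 1 ≤ K → K < p →
    p * ∣ K * J p 𝓜 H - H * J p 𝓜 K ∣
      ≤ c * ((H + K) * (H * K + p) * ∣ 𝓜 ∣ ^ 2)
lemma3p2 = 4 , estimate
  where
  estimate : (p : ℕ) .{{_ : NonZero p}} → Prime p →
    (𝓜 : Subset p) → (∀ m → m ∈ 𝓜 → toℕ m ≢ 0) →
    (H K : ℕ) → 1 ≤ H → H < p → 1 ≤ K → K < p →
    p * ∣ K * J p 𝓜 H - H * J p 𝓜 K ∣ ≤ 4 * ((H + K) * (H * K + p) * ∣ 𝓜 ∣ ^ 2)
  estimate p p-prime 𝓜 𝓜-nonzero H K _ H<p _ K<p = begin
    p * ∣ K * J p 𝓜 H - H * J p 𝓜 K ∣           ≡⟨ *-distribˡ-∣-∣ p (K * J p 𝓜 H) (H * J p 𝓜 K) ⟩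
    ∣ p * (K * J p 𝓜 H) - p * (H * J p 𝓜 K) ∣   ≤⟨ dist≤ (one-sided H K H<p) backwards ⟩
    bound H K                                 ∎
    where
    open ≤-Reasoning
    open Summation p p-prime 𝓜 𝓜-nonzero
    backwards : p * (H * J p 𝓜 K) ≤ p * (K * J p 𝓜 H) + bound H K
    backwards = subst (λ b → p * (H * J p 𝓜 K) ≤ p * (K * J p 𝓜 H) + b) (bound-sym H K)
                      (one-sided K H K<p)
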